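{- For each $(q,r)\in\{(3,2),(5,2),(3,3)\}$ there exist $\mathbb{F}_q$-affine hyperplanes $C_1,\dots,C_r$ of $\mathbb{F}_{q^r}$ in general position such that every primitive element of $\mathbb{F}_{q^r}$ lies in $\bigcup_{i=1}^rC_i$; that is, $\mathcal{G}_{\mathcal{A}}=\mathbb{F}_{q^r}\setminus\bigcup_{i=1}^rC_i$ contains no primitive element.
   Context: View $\mathbb{F}_{q^r}$ as an $r$-dimensional $\mathbb{F}_q$-vector space; an $\mathbb{F}_q$-affine hyperplane is $\{x: L(x)=c\}$ with $L$ a nonzero $\mathbb{F}_q$-linear functional $\mathbb{F}_{q^r}\to\mathbb{F}_q$ and $c\in\mathbb{F}_q$; $C_i=\{L_i(x)=c_i\}$, $i=1,\dots,r$, are in general position if $L_1,\dots,L_r$ are linearly independent. A primitive element is a generator of $\mathbb{F}_{q^r}^*$. -}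

module Defs where

open import Data.Nat using (ℕ; zero; suc; NonZero)
import Data.Nat as ℕ
open import Data.Nat.DivMod using (_mod_)
open import Data.Fin using (Fin; toℕ; #_)
open import Data.Vec using (Vec; []; _∷_; zipWith; map; replicate; tabulate; foldr; init; last; lookup)
open import Data.Product using (Σ; ∃; ∃-syntax; _×_; _,_)
open import Relation.Binary.PropositionalEquality using (_≡_)
open import Relation.Nullary using (¬_)

module PrimeField (p : ℕ) .{{_ : NonZero p}} where

  F : Set
  F = Fin p

  0F 1F : F
  0F = 0 mod p
  1F = 1 mod p

  _+F_ _*F_ : F → F → F
  a +F b = (toℕ a ℕ.+ toℕ b) mod p
  a *F b = (toℕ a ℕ.* toℕ b) mod p

  -F_ : F → F
  -F a = (p ℕ.∸ toℕ a) mod p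

-- The extension field F_{p^n} = F_p[x]/(f), where
--   f = x^n + c₀ + c₁ x + … + c_{n-1} x^{n-1}
-- is a fixed monic irreducible polynomial given by c = (c₀,…,c_{n-1}).
-- Elements are coefficient vectors (a₀,…,a_{n-1}) w.r.t. 1,x,…,x^{n-1};
-- this is the standard model of F_{p^n} as an n-dim F_p-vector space.

module ExtField (p : ℕ) .{{_ : NonZero p}} (n : ℕ) (c : Vec (Fin p) n) where

  open PrimeField p public

  K : Set
  K = Vec F n

  0K : K
  0K = replicate n 0F

  1K : K
  1K = tabulate (λ i → aux (toℕ i))
    where
    aux : ℕ → F
    aux zero    = 1F
    aux (suc _) = 0F

  _+K_ : K → K → K
  _+K_ = zipWith _+F_

  _·K_ : F → K → K
  s ·K a = map (s *F_) a

  mulX : K → K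
  mulX {- n = 0 -} = go n c
    where
    go : (m : ℕ) → Vec F m → Vec F m → Vec F m
    go zero    _  a = a
    go (suc m) cs a = zipWith _+F_ (0F ∷ init a) (map (λ ci → -F (last a *F ci)) cs)

  -- a * b = Σ_j b_j x^j a, by Horner's scheme on the coefficients of b
  _*K_ : K → K → K
  a *K b = foldr (λ _ → K) (λ bj acc → (bj ·K a) +K mulX acc) 0K b

  _^K_ : K → ℕ → K
  g ^K zero  = 1K
  g ^K suc k = g *K (g ^K k)

  IsPrimitive : K → Set
  IsPrimitive g = ¬ (g ≡ 0K) × (∀ (y : K) → ¬ (y ≡ 0K) → ∃[ k ] (g ^K k ≡ y))

  IsLinear : (K → F) → Set
  IsLinear L = (∀ x y → L (x +K y) ≡ L x +F L y) × (∀ s x → L (s ·K x) ≡ s *F L x)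

  LinIndep : {r : ℕ} → Vec (K → F) r → Set
  LinIndep {r} Ls =
    ∀ (a : Vec F r) →
      (∀ x → foldr (λ _ → F) _+F_ 0F (zipWith (λ ai Li → ai *F Li x) a Ls) ≡ 0F) →
      a ≡ replicate r 0F

  PrimitivesCoveredByHyperplanes : Set
  PrimitivesCoveredByHyperplanes =
    Σ (Vec (K → F) n) λ Ls → Σ (Vec F n) λ cs →
      (∀ i → IsLinear (lookup Ls i)) ×
      (∀ i → ¬ (∀ x → lookup Ls i x ≡ 0F)) ×
      LinIndep Ls ×
      (∀ g → IsPrimitive g → ∃[ i ] (lookup Ls i g ≡ lookup cs i))

-- Concrete models:
--   F_9  = F_3[x]/(x^2 + 1)
--   F_25 = F_5[x]/(x^2 + 2)
--   F_27 = F_3[x]/(x^3 + 2x + 1)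
-- (each modulus is irreducible over the prime field)
module F9  = ExtField 3 2 (# 1 ∷ # 0 ∷ [])
module F25 = ExtField 5 2 (# 2 ∷ # 0 ∷ [])
module F27 = ExtField 3 3 (# 1 ∷ # 2 ∷ # 0 ∷ [])

{-# OPTIONS --safe #-}
module Submission where

-- Every field here is finite, so linearity, non-vanishing and linear independence of the
-- chosen functionals are decided by enumerating the field.  Primitivity is not decidable
-- this way (its exponent is unbounded), so it is refuted instead: if the list of powers
-- g⁰, …, g^(pⁿ) is closed under multiplication by g, it contains every power of g, and a
-- nonzero element missing from it shows that g is not a generator.

open import Defs
open import Data.Empty using (⊥-elim)
open import Data.Fin using (Fin; #_)
import Data.Fin.Properties as Fin
open import Data.List using (List; []; _∷_; cartesianProductWith; iterate)
open import Data.List.Membership.Propositional using (_∈_; _∉_)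
open import Data.List.Membership.Propositional.Properties using (∈-allFin; ∈-cartesianProductWith⁺)
open import Data.List.Relation.Unary.All as All using (All)
open import Data.List.Relation.Unary.Any as Any using (here)
import Data.List.Relation.Unary.Enumerates.Setoid as Enumerates
open import Data.Nat using (ℕ; zero; suc; _^_; NonZero)
open import Data.Product using (∃; ∃-syntax; _×_; _,_)
open import Data.Sum using (_⊎_; inj₁; inj₂)
open import Data.Unit using (tt)
open import Data.Vec using (Vec; []; _∷_; zipWith; foldr; lookup; replicate; map)
import Data.Vec.Properties as Vec
open import Function using (_∘_)
open import Relation.Binary.Definitions using (DecidableEquality)
open import Relation.Binary.PropositionalEquality using (_≡_; _≢_; refl; subst; setoid)
open import Relation.Nullary using (¬_; Dec; ¬?)
open import Relation.Nullary.Decidable using (True; toWitness; map′; _×-dec_; _⊎-dec_; _→-dec_)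
open import Relation.Unary using (Pred; Decidable)

IsEnumeration : {A : Set} → List A → Set
IsEnumeration {A} = Enumerates.IsEnumeration (setoid A)

module Enumerated {A : Set} {xs : List A} (xs-enum : IsEnumeration xs) where

  all? : ∀ {ℓ} {P : Pred A ℓ} → Decidable P → Dec (∀ x → P x)
  all? P? = map′ (λ ps x → All.lookup ps (xs-enum x)) (λ ps → All.tabulate (λ {x} _ → ps x))
                 (All.all? P? xs)

  any? : ∀ {ℓ} {P : Pred A ℓ} → Decidable P → Dec (∃ P)
  any? P? = map′ Any.satisfied (λ (x , px) → Any.map (λ { refl → px }) (xs-enum x))
                 (Any.any? P? xs)

allVecs : {A : Set} → List A → (n : ℕ) → List (Vec A n)
allVecs xs zero    = [] ∷ []
allVecs xs (suc n) = cartesianProductWith _∷_ xs (allVecs xs n)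

allVecs-isEnumeration : {A : Set} {xs : List A} →
                        IsEnumeration xs → ∀ n → IsEnumeration (allVecs xs n)
allVecs-isEnumeration xs-enum zero    []       = here refl
allVecs-isEnumeration xs-enum (suc n) (x ∷ v) =
  ∈-cartesianProductWith⁺ _∷_ (xs-enum x) (allVecs-isEnumeration xs-enum n v)

module Certification (p : ℕ) .{{_ : NonZero p}} (n : ℕ) (c : Vec (Fin p) n) where
  open ExtField p n c

  _≟K_ : DecidableEquality K
  _≟K_ = Vec.≡-dec Fin._≟_

  open import Data.List.Membership.DecPropositional _≟K_ using (_∈?_)

  open Enumerated (allVecs-isEnumeration (∈-allFin {p}) n) renaming (all? to ∀K?; any? to ∃K?)
  open Enumerated (∈-allFin {p}) using () renaming (all? to ∀F?)

  MulClosed : K → List K → Set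
  MulClosed g S = All (λ x → g *K x ∈ S) S

  ^K∈mulClosed : ∀ {g S} → 1K ∈ S → MulClosed g S → ∀ k → g ^K k ∈ S
  ^K∈mulClosed 1∈S closed zero    = 1∈S
  ^K∈mulClosed 1∈S closed (suc k) = All.lookup closed (^K∈mulClosed 1∈S closed k)

  mulClosed-missing⇒¬IsPrimitive : ∀ {g y S} → 1K ∈ S → MulClosed g S →
                                   y ≢ 0K → y ∉ S → ¬ IsPrimitive g
  mulClosed-missing⇒¬IsPrimitive {y = y} 1∈S closed y≢0 y∉S (_ , generates)
    with generates y y≢0
  ... | k , gᵏ≡y = y∉S (subst (_∈ _) gᵏ≡y (^K∈mulClosed 1∈S closed k))

  powers : K → List K
  powers g = iterate (g *K_) 1K (suc (p ^ n))

  NonPrimitivityWitness : K → Set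
  NonPrimitivityWitness g = MulClosed g (powers g) × ∃[ y ] (y ≢ 0K × y ∉ powers g)

  nonPrimitivityWitness? : Decidable NonPrimitivityWitness
  nonPrimitivityWitness? g =
    All.all? (λ x → g *K x ∈? powers g) (powers g)
    ×-dec ∃K? (λ y → ¬? (y ≟K 0K) ×-dec ¬? (y ∈? powers g))

  nonPrimitivityWitness⇒¬IsPrimitive : ∀ {g} → NonPrimitivityWitness g → ¬ IsPrimitive g
  nonPrimitivityWitness⇒¬IsPrimitive (closed , _ , y≢0 , y∉) =
    mulClosed-missing⇒¬IsPrimitive (here refl) closed y≢0 y∉

  isLinear? : (L : K → F) → Dec (IsLinear L)
  isLinear? L =
    ∀K? (λ x → ∀K? (λ y → L (x +K y) Fin.≟ L x +F L y))
    ×-dec ∀F? (λ s → ∀K? (λ x → L (s ·K x) Fin.≟ s *F L x))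

  isNonzero? : (L : K → F) → Dec (¬ ∀ x → L x ≡ 0F)
  isNonzero? L = ¬? (∀K? (λ x → L x Fin.≟ 0F))

  linIndep? : ∀ {r} (Ls : Vec (K → F) r) → Dec (LinIndep Ls)
  linIndep? {r} Ls = ∀a? λ a →
    ∀K? (λ x → foldr (λ _ → F) _+F_ 0F (zipWith (λ ai Li → ai *F Li x) a Ls) Fin.≟ 0F)
    →-dec Vec.≡-dec Fin._≟_ a (replicate r 0F)
    where open Enumerated (allVecs-isEnumeration (∈-allFin {p}) r) using () renaming (all? to ∀a?)

  CertifiedCover : Vec (K → F) n → Vec F n → Set
  CertifiedCover Ls cs =
    (∀ i → IsLinear (lookup Ls i)) ×
    (∀ i → ¬ ∀ x → lookup Ls i x ≡ 0F) ×
    LinIndep Ls ×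
    (∀ g → ∃[ i ] (lookup Ls i g ≡ lookup cs i) ⊎ NonPrimitivityWitness g)

  certifiedCover? : ∀ Ls cs → Dec (CertifiedCover Ls cs)
  certifiedCover? Ls cs =
    Fin.all? (isLinear? ∘ lookup Ls) ×-dec Fin.all? (isNonzero? ∘ lookup Ls) ×-dec linIndep? Ls
    ×-dec ∀K? (λ g → Fin.any? (λ i → lookup Ls i g Fin.≟ lookup cs i)
                     ⊎-dec nonPrimitivityWitness? g)

  certifiedCover⇒primitivesCovered : ∀ {Ls cs} → CertifiedCover Ls cs → PrimitivesCoveredByHyperplanes
  certifiedCover⇒primitivesCovered {Ls} {cs} (linear , nonzero , indep , cover) =
    Ls , cs , linear , nonzero , indep , covered
    where
    covered : ∀ g → IsPrimitive g → ∃[ i ] (lookup Ls i g ≡ lookup cs i)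
    covered g isPrimitive with cover g
    ... | inj₁ g∈C     = g∈C
    ... | inj₂ witness = ⊥-elim (nonPrimitivityWitness⇒¬IsPrimitive witness isPrimitive)

  linearForm : Vec F n → K → F
  linearForm w a = foldr (λ _ → F) _+F_ 0F (zipWith _*F_ w a)

  coveredBy : (ws : Vec (Vec F n) n) (cs : Vec F n) →
              True (certifiedCover? (map linearForm ws) cs) →
              PrimitivesCoveredByHyperplanes
  coveredBy ws cs certified = certifiedCover⇒primitivesCovered {cs = cs} (toWitness certified)

module C9  = Certification 3 2 (# 1 ∷ # 0 ∷ [])
module C25 = Certification 5 2 (# 2 ∷ # 0 ∷ [])
module C27 = Certification 3 3 (# 1 ∷ # 2 ∷ # 0 ∷ [])

-- In 𝔽₉ and 𝔽₂₅ every primitive element a₀ + a₁x lies on one of the lines a₀ = ±a₁.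
proposition30 : F9.PrimitivesCoveredByHyperplanes × F25.PrimitivesCoveredByHyperplanes × F27.PrimitivesCoveredByHyperplanes
proposition30 =
  C9.coveredBy  ((# 1 ∷ # 1 ∷ []) ∷ (# 1 ∷ # 2 ∷ []) ∷ []) (# 0 ∷ # 0 ∷ []) tt ,
  C25.coveredBy ((# 1 ∷ # 1 ∷ []) ∷ (# 1 ∷ # 4 ∷ []) ∷ []) (# 0 ∷ # 0 ∷ []) tt ,
  C27.coveredBy ((# 0 ∷ # 0 ∷ # 1 ∷ []) ∷ (# 0 ∷ # 1 ∷ # 0 ∷ []) ∷ (# 1 ∷ # 1 ∷ # 0 ∷ []) ∷ [])
                (# 2 ∷ # 1 ∷ # 1 ∷ []) tt
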